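{- For all $n\ge0$, $I_{n,1}=\sum_{i=0}^{n}C_iF_{n-i}$, i.e. $I_{n,1}$ is the $n$-th term of the convolution of the Catalan numbers with the Fine numbers.
   Context: $I_{n,1}$ is the number of ascending (weakly increasing) $1$-Naples parking functions of length $n$ (with $I_{0,1}=1$). Parking rules: $n$ spots $1,\dots,n$; cars $c_1,\dots,c_n$ arrive in order with preferences $a_j\in[n]$; $1$-Naples rule: $c_j$ parks at $a_j$ if empty, otherwise parks at $a_j-1$ if that spot exists and is empty, otherwise drives forward from $a_j$ and parks in the first empty spot after $a_j$ (failing if none); a $1$-Naples parking function is a preference for which all cars park. $C_m=\frac1{m+1}\binom{2m}{m}$ are the Catalan numbers with generating function $C(x)$, and the Fine numbers $F_m$ are defined by $\sum_{m\ge0}F_mx^m=\frac{1}{1-x^2C(x)^2}$ (OEIS A000957). -}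

module Defs where

open import Data.Nat using (ℕ; zero; suc; _+_; _*_; _∸_; _/_; _≡ᵇ_; _≤ᵇ_; _<ᵇ_)
open import Data.Nat.Combinatorics using (_C_)
open import Data.Bool using (Bool; true; false; not; _∧_; _∨_; if_then_else_)
open import Data.List using (List; []; _∷_; map; upTo; length; filterᵇ; concatMap)
open import Data.Nat.ListAction using (sum)
open import Data.Bool.ListAction using (any)
open import Data.Maybe using (Maybe; just; nothing; is-just)
open import Relation.Binary.PropositionalEquality using (_≡_)

sumTo : ℕ → (ℕ → ℕ) → ℕ
sumTo n f = sum (map f (upTo (suc n)))

catalan : ℕ → ℕ
catalan m = ((2 * m) C m) / suc m

-- Fine numbers: generating function 1/(1 - x^2 C(x)^2).
-- Coefficients of C(x)^2 and of G(x) = x^2 C(x)^2: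

catalanSq : ℕ → ℕ
catalanSq j = sumTo j (λ i → catalan i * catalan (j ∸ i))

gCoeff : ℕ → ℕ
gCoeff zero = 0
gCoeff (suc zero) = 0
gCoeff (suc (suc j)) = catalanSq j

δ₀ : ℕ → ℕ
δ₀ zero = 1
δ₀ (suc _) = 0

-- F(x) = 1/(1 - G(x))  ⇔  F(x) = 1 + G(x) F(x)  (coefficientwise).
-- Since G has zero constant term, this uniquely determines F.
IsFineSequence : (ℕ → ℕ) → Set
IsFineSequence F = ∀ m → F m ≡ δ₀ m + sumTo m (λ k → gCoeff k * F (m ∸ k))

-- 1-Naples parking.  Spots 1..n; occupancy = list of occupied spots.

occupied : List ℕ → ℕ → Bool
occupied occ p = any (λ s → s ≡ᵇ p) occ

firstEmptyAfter : ℕ → List ℕ → ℕ → Maybe ℕ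
firstEmptyAfter n occ a = go (map (λ i → suc (a + i)) (upTo (n ∸ a)))
  where
  go : List ℕ → Maybe ℕ
  go [] = nothing
  go (b ∷ bs) = if occupied occ b then go bs else just b

parkCar : ℕ → List ℕ → ℕ → Maybe ℕ
parkCar n occ a =
  if not (occupied occ a) then just a
  else (if (1 <ᵇ a) ∧ not (occupied occ (a ∸ 1)) then just (a ∸ 1)
        else firstEmptyAfter n occ a)

parkAll : ℕ → List ℕ → List ℕ → Maybe (List ℕ)
parkAll n occ [] = just occ
parkAll n occ (a ∷ as) with parkCar n occ a
... | nothing = nothing
... | just s = parkAll n (s ∷ occ) as

isNaplesPF : ℕ → List ℕ → Bool
isNaplesPF n prefs = is-just (parkAll n [] prefs)

allSeqs : ℕ → ℕ → List (List ℕ)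
allSeqs zero n = [] ∷ []
allSeqs (suc len) n =
  concatMap (λ v → map (v ∷_) (allSeqs len n)) (map suc (upTo n))

weaklyIncreasing : List ℕ → Bool
weaklyIncreasing [] = true
weaklyIncreasing (a ∷ []) = true
weaklyIncreasing (a ∷ b ∷ rest) = (a ≤ᵇ b) ∧ weaklyIncreasing (b ∷ rest)

I₁ : ℕ → ℕ
I₁ n = length (filterᵇ (λ p → weaklyIncreasing p ∧ isNaplesPF n p) (allSeqs n n))

{-# OPTIONS --safe #-}
module Submission where

-- With weakly increasing preferences the occupied spots always form an initial segment 1..r, up to
-- one detour: a car preferring the empty spot r+2 parks there, and then spot r+1 can only be filled
-- if the next car prefers exactly r+2 and is sent back.  So the number of ways to finish from the
-- segment 1..r, with k cars left and the next preference allowed to be any of the top s occupied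
-- spots, satisfies the recursion of [xᵏ] C(x)^(s+1) (from C = 1 + x C²) plus one detour term.
-- By the Fine equation F = 1 + x² C² F that detour term is the Fine number F_k, and the count is
-- [xᵏ] C(x)^(s+1) F(x); the theorem is the case r = s = 0.  The Catalan powers are identified with
-- the Catalan numbers of the statement through the ballot formula.

open import Defs
open import Data.Nat
open import Data.Nat.Properties
open import Algebra.Properties.CommutativeSemigroup +-commutativeSemigroup using (interchange)
open import Data.Nat.Combinatorics using (_C_; nCk+nC[k+1]≡[n+1]C[k+1]; nC1≡n; nCk≡nC[n∸k])
open import Data.Nat.DivMod using (m*n/n≡m)
open import Data.Nat.ListAction using (sum)
open import Data.Bool using (Bool; true; false; not; _∧_; _∨_; if_then_else_; T; T?)
open import Data.Bool.Properties using (T-≡; ¬-not; ∧-zeroʳ)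
open import Data.List using (List; []; _∷_; map; upTo; applyUpTo; length; filterᵇ; concatMap; _++_)
open import Data.List.Properties using (filter-++; filter-≐; length-++; map-applyUpTo)
open import Data.Maybe using (Maybe; just; nothing; is-just; maybe′)
open import Data.Product using (_×_; _,_)
open import Data.Empty using (⊥-elim)
open import Function using (_∘_; id; Equivalence)
open import Relation.Binary.Definitions using (tri<; tri≈; tri>)
open import Relation.Binary.PropositionalEquality
open import Relation.Nullary using (¬_; yes; no)
open ≡-Reasoning

-- Finite sums and Cauchy products

∑ : ℕ → (ℕ → ℕ) → ℕ
∑ zero    f = 0
∑ (suc m) f = f 0 + ∑ m (f ∘ suc)

sum-map-applyUpTo : ∀ m (f g : ℕ → ℕ) → sum (map f (applyUpTo g m)) ≡ ∑ m (f ∘ g)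
sum-map-applyUpTo zero    f g = refl
sum-map-applyUpTo (suc m) f g = cong (f (g 0) +_) (sum-map-applyUpTo m f (g ∘ suc))

sumTo≡∑ : ∀ n f → sumTo n f ≡ ∑ (suc n) f
sumTo≡∑ n f = sum-map-applyUpTo (suc n) f id

∑-cong : ∀ m {f g : ℕ → ℕ} → (∀ i → f i ≡ g i) → ∑ m f ≡ ∑ m g
∑-cong zero    f≗g = refl
∑-cong (suc m) f≗g = cong₂ _+_ (f≗g 0) (∑-cong m (f≗g ∘ suc))

∑-distrib-+ : ∀ m (f g : ℕ → ℕ) → ∑ m (λ i → f i + g i) ≡ ∑ m f + ∑ m g
∑-distrib-+ zero    f g = refl
∑-distrib-+ (suc m) f g = begin
  (f 0 + g 0) + ∑ m (λ i → f (suc i) + g (suc i))  ≡⟨ cong ((f 0 + g 0) +_) (∑-distrib-+ m (f ∘ suc) (g ∘ suc)) ⟩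
  (f 0 + g 0) + (∑ m (f ∘ suc) + ∑ m (g ∘ suc))    ≡⟨ interchange (f 0) (g 0) _ _ ⟩
  ∑ (suc m) f + ∑ (suc m) g                        ∎

∑-≡0 : ∀ m {f : ℕ → ℕ} → (∀ i → i < m → f i ≡ 0) → ∑ m f ≡ 0
∑-≡0 zero    f≡0 = refl
∑-≡0 (suc m) f≡0 = cong₂ _+_ (f≡0 0 z<s) (∑-≡0 m (λ i i<m → f≡0 (suc i) (s<s i<m)))

∑-const : ∀ m c → ∑ m (λ _ → c) ≡ m * c
∑-const zero    c = refl
∑-const (suc m) c = cong (c +_) (∑-const m c)

∑-split : ∀ m l (f : ℕ → ℕ) → ∑ (m + l) f ≡ ∑ m f + ∑ l (λ i → f (m + i))
∑-split zero    l f = refl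
∑-split (suc m) l f = trans (cong (f 0 +_) (∑-split m l (f ∘ suc))) (sym (+-assoc (f 0) _ _))

∑-indicator : ∀ m j (g : ℕ → ℕ) → ∑ m (λ i → if i ≡ᵇ j then g i else 0) ≡ (if j <ᵇ m then g j else 0)
∑-indicator zero    j       g = refl
∑-indicator (suc m) zero    g = trans (cong (g 0 +_) (∑-≡0 m (λ _ _ → refl))) (+-identityʳ (g 0))
∑-indicator (suc m) (suc j) g = ∑-indicator m j (g ∘ suc)

_⋆_ : (ℕ → ℕ) → (ℕ → ℕ) → ℕ → ℕ
(a ⋆ b) k = ∑ (suc k) (λ i → a i * b (k ∸ i))

-- Powers of the Catalan series and the Fine recursion

-- ballot s k = [xᵏ] C(x)^(s+1); the recursion is C = 1 + x C² multiplied by C^s.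
ballot : ℕ → ℕ → ℕ
ballot s       zero    = 1
ballot zero    (suc k) = ballot 1 k
ballot (suc s) (suc k) = ballot s (suc k) + ballot (suc (suc s)) k

⋆-ballot-0 : ∀ (g : ℕ → ℕ) k → (ballot 0 ⋆ g) (suc k) ≡ g (suc k) + (ballot 1 ⋆ g) k
⋆-ballot-0 g k = cong (_+ (ballot 1 ⋆ g) k) (+-identityʳ (g (suc k)))

⋆-ballot-suc : ∀ (g : ℕ → ℕ) s k → (ballot (suc s) ⋆ g) (suc k) ≡ (ballot s ⋆ g) (suc k) + (ballot (suc (suc s)) ⋆ g) k
⋆-ballot-suc g s k = begin
  g (suc k) + 0 + ∑ (suc k) (λ i → (ballot s (suc i) + ballot (suc (suc s)) i) * g (k ∸ i))
    ≡⟨ cong (g (suc k) + 0 +_) (trans (∑-cong (suc k) (λ i → *-distribʳ-+ (g (k ∸ i)) (ballot s (suc i)) (ballot (suc (suc s)) i)))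
                                      (∑-distrib-+ (suc k) (λ i → ballot s (suc i) * g (k ∸ i))
                                                           (λ i → ballot (suc (suc s)) i * g (k ∸ i)))) ⟩
  g (suc k) + 0 + (∑ (suc k) (λ i → ballot s (suc i) * g (k ∸ i)) + (ballot (suc (suc s)) ⋆ g) k)
    ≡⟨ +-assoc (g (suc k) + 0) _ _ ⟨
  (ballot s ⋆ g) (suc k) + (ballot (suc (suc s)) ⋆ g) k
    ∎

ballot-convolution : ∀ s t k → (ballot s ⋆ ballot t) k ≡ ballot (suc (s + t)) k
ballot-convolution s       t zero    = refl
ballot-convolution zero    t (suc k) = trans (⋆-ballot-0 (ballot t) k) (cong (ballot t (suc k) +_) (ballot-convolution 1 t k))
ballot-convolution (suc s) t (suc k) =
  trans (⋆-ballot-suc (ballot t) s k) (cong₂ _+_ (ballot-convolution s t (suc k)) (ballot-convolution (suc (suc s)) t k))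

[1+k]*[1+n]C[1+k]≡[1+n]*nCk : ∀ n k → suc k * (suc n C suc k) ≡ suc n * (n C k)
[1+k]*[1+n]C[1+k]≡[1+n]*nCk zero    zero    = refl
[1+k]*[1+n]C[1+k]≡[1+n]*nCk zero    (suc k) = *-zeroʳ (suc (suc k))
[1+k]*[1+n]C[1+k]≡[1+n]*nCk (suc n) zero    =
  trans (+-identityʳ _) (trans (nC1≡n (suc (suc n))) (cong suc (sym (*-identityʳ (suc n)))))
[1+k]*[1+n]C[1+k]≡[1+n]*nCk (suc n) (suc k) = begin
  suc (suc k) * (suc (suc n) C suc (suc k))      ≡⟨ cong (suc (suc k) *_) (nCk+nC[k+1]≡[n+1]C[k+1] (suc n) (suc k)) ⟨
  suc (suc k) * (A + B)                          ≡⟨ *-distribˡ-+ (suc (suc k)) A B ⟩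
  suc (suc k) * A + suc (suc k) * B              ≡⟨ +-assoc A (suc k * A) _ ⟩
  A + (suc k * A + suc (suc k) * B)
    ≡⟨ cong (A +_) (cong₂ _+_ ([1+k]*[1+n]C[1+k]≡[1+n]*nCk n k) ([1+k]*[1+n]C[1+k]≡[1+n]*nCk n (suc k))) ⟩
  A + (suc n * (n C k) + suc n * (n C suc k))    ≡⟨ cong (A +_) (*-distribˡ-+ (suc n) (n C k) (n C suc k)) ⟨
  A + suc n * (n C k + n C suc k)                ≡⟨ cong (λ z → A + suc n * z) (nCk+nC[k+1]≡[n+1]C[k+1] n k) ⟩
  suc (suc n) * A                                ∎
  where
  A : ℕ
  A = suc n C suc k
  B : ℕ
  B = suc n C suc (suc k)

ballot-1 : ∀ s → ballot s 1 ≡ suc s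
ballot-1 zero    = refl
ballot-1 (suc s) = trans (cong (_+ 1) (ballot-1 s)) (+-comm (suc s) 1)

[3+2k]C[2+k]≡[3+2k]C[1+k] : ∀ k → suc (suc (suc (k + k))) C suc (suc k) ≡ suc (suc (suc (k + k))) C suc k
[3+2k]C[2+k]≡[3+2k]C[1+k] k = trans (nCk≡nC[n∸k] 2+k≤3+2k) (cong (suc (suc (suc (k + k))) C_) 1+2k∸k≡1+k)
  where
  2+k≤3+2k : suc (suc k) ≤ suc (suc (suc (k + k)))
  2+k≤3+2k = s≤s (s≤s (≤-trans (m≤m+n k k) (n≤1+n _)))
  1+2k∸k≡1+k : suc (k + k) ∸ k ≡ suc k
  1+2k∸k≡1+k = trans (cong (_∸ k) (sym (+-suc k k))) (m+n∸m≡n k (suc k))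

ballot-closedForm : ∀ s k → ballot s (suc k) + suc (suc (s + (k + k))) C k ≡ suc (suc (s + (k + k))) C suc k
ballot-closedForm s zero = begin
  ballot s 1 + 1             ≡⟨ cong (_+ 1) (ballot-1 s) ⟩
  suc s + 1                  ≡⟨ +-comm (suc s) 1 ⟩
  suc (suc s)                ≡⟨ cong (λ z → suc (suc z)) (+-identityʳ s) ⟨
  suc (suc (s + 0))          ≡⟨ nC1≡n (suc (suc (s + 0))) ⟨
  suc (suc (s + 0)) C 1      ∎
ballot-closedForm zero (suc k) =
  subst (λ N → ballot 1 (suc k) + N C suc k ≡ N C suc (suc k)) (cong (λ z → suc (suc (suc z))) (sym (+-suc k k))) (begin
    ballot 1 (suc k) + suc M C suc k          ≡⟨ cong (ballot 1 (suc k) +_) (nCk+nC[k+1]≡[n+1]C[k+1] M k) ⟨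
    ballot 1 (suc k) + (M C k + M C suc k)    ≡⟨ +-assoc (ballot 1 (suc k)) _ _ ⟨
    ballot 1 (suc k) + M C k + M C suc k      ≡⟨ cong (_+ M C suc k) (ballot-closedForm 1 k) ⟩
    M C suc k + M C suc k                     ≡⟨ cong (M C suc k +_) ([3+2k]C[2+k]≡[3+2k]C[1+k] k) ⟨
    M C suc k + M C suc (suc k)               ≡⟨ nCk+nC[k+1]≡[n+1]C[k+1] M (suc k) ⟩
    suc M C suc (suc k)                       ∎)
  where
  M : ℕ
  M = suc (suc (suc (k + k)))
ballot-closedForm (suc s) (suc k) = begin
  (ballot s (suc (suc k)) + ballot (suc (suc s)) (suc k)) + suc P C suc k
    ≡⟨ cong (ballot s (suc (suc k)) + ballot (suc (suc s)) (suc k) +_) (nCk+nC[k+1]≡[n+1]C[k+1] P k) ⟨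
  (ballot s (suc (suc k)) + ballot (suc (suc s)) (suc k)) + (P C k + P C suc k)
    ≡⟨ cong (ballot s (suc (suc k)) + ballot (suc (suc s)) (suc k) +_) (+-comm (P C k) (P C suc k)) ⟩
  (ballot s (suc (suc k)) + ballot (suc (suc s)) (suc k)) + (P C suc k + P C k)
    ≡⟨ interchange (ballot s (suc (suc k))) _ (P C suc k) _ ⟩
  (ballot s (suc (suc k)) + P C suc k) + (ballot (suc (suc s)) (suc k) + P C k)
    ≡⟨ cong₂ _+_ (ballot-closedForm s (suc k))
                 (subst (λ N → ballot (suc (suc s)) (suc k) + N C k ≡ N C suc k) N≡P (ballot-closedForm (suc (suc s)) k)) ⟩
  P C suc (suc k) + P C suc k
    ≡⟨ +-comm (P C suc (suc k)) (P C suc k) ⟩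
  P C suc k + P C suc (suc k)
    ≡⟨ nCk+nC[k+1]≡[n+1]C[k+1] P (suc k) ⟩
  suc P C suc (suc k) ∎
  where
  P : ℕ
  P = suc (suc (s + (suc k + suc k)))
  N≡P : suc (suc (suc (suc s) + (k + k))) ≡ P
  N≡P = cong (λ z → suc (suc z)) (sym (trans (cong (s +_) (+-suc (suc k) k)) (trans (+-suc s (suc (k + k))) (cong suc (+-suc s (k + k))))))

[2+j]*[2+2j]Cj≡[1+j]*[2+2j]C[1+j] : ∀ j → suc (suc j) * (suc (suc (j + j)) C j) ≡ suc j * (suc (suc (j + j)) C suc j)
[2+j]*[2+2j]Cj≡[1+j]*[2+2j]C[1+j] j = begin
  suc (suc j) * (W C j)                  ≡⟨ cong (suc (suc j) *_) WCj≡WC[2+j] ⟩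
  suc (suc j) * (W C suc (suc j))        ≡⟨ [1+k]*[1+n]C[1+k]≡[1+n]*nCk (suc (j + j)) (suc j) ⟩
  W * (suc (j + j) C suc j)              ≡⟨ cong (W *_) [1+2j]C[1+j]≡[1+2j]Cj ⟩
  W * (suc (j + j) C j)                  ≡⟨ [1+k]*[1+n]C[1+k]≡[1+n]*nCk (suc (j + j)) j ⟨
  suc j * (W C suc j)                    ∎
  where
  W : ℕ
  W = suc (suc (j + j))
  WCj≡WC[2+j] : W C j ≡ W C suc (suc j)
  WCj≡WC[2+j] = sym (trans (nCk≡nC[n∸k] (s≤s (s≤s (m≤n+m j j)))) (cong (W C_) (m+n∸m≡n j j)))
  [1+2j]C[1+j]≡[1+2j]Cj : suc (j + j) C suc j ≡ suc (j + j) C j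
  [1+2j]C[1+j]≡[1+2j]Cj = trans (nCk≡nC[n∸k] (s≤s (m≤n+m j j))) (cong (suc (j + j) C_) (m+n∸m≡n j j))

catalan≡ballot : ∀ j → catalan j ≡ ballot 0 j
catalan≡ballot zero    = refl
catalan≡ballot (suc j) = begin
  ((2 * suc j) C suc j) / suc (suc j)   ≡⟨ cong (λ z → (z C suc j) / suc (suc j)) 2[1+j]≡W ⟩
  X / suc (suc j)                       ≡⟨ cong (_/ suc (suc j)) (trans (sym [2+j]*G≡X) (*-comm (suc (suc j)) G)) ⟩
  (G * suc (suc j)) / suc (suc j)       ≡⟨ m*n/n≡m G (suc (suc j)) ⟩
  G                                     ∎
  where
  W : ℕ
  W = suc (suc (j + j))
  X : ℕ
  X = W C suc j
  G : ℕ
  G = ballot 0 (suc j)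
  2[1+j]≡W : 2 * suc j ≡ W
  2[1+j]≡W = cong suc (trans (+-suc j (j + 0)) (cong (λ z → suc (j + z)) (+-identityʳ j)))
  [2+j]*G≡X : suc (suc j) * G ≡ X
  [2+j]*G≡X = +-cancelʳ-≡ (suc j * X) _ _ (begin
    suc (suc j) * G + suc j * X            ≡⟨ cong (suc (suc j) * G +_) ([2+j]*[2+2j]Cj≡[1+j]*[2+2j]C[1+j] j) ⟨
    suc (suc j) * G + suc (suc j) * (W C j) ≡⟨ *-distribˡ-+ (suc (suc j)) G (W C j) ⟨
    suc (suc j) * (G + W C j)              ≡⟨ cong (suc (suc j) *_) (ballot-closedForm 0 j) ⟩
    suc (suc j) * X                        ∎)

catalanSq≡ballot : ∀ j → catalanSq j ≡ ballot 1 j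
catalanSq≡ballot j = begin
  catalanSq j            ≡⟨ sumTo≡∑ j _ ⟩
  (catalan ⋆ catalan) j  ≡⟨ ∑-cong (suc j) (λ i → cong₂ _*_ (catalan≡ballot i) (catalan≡ballot (j ∸ i))) ⟩
  (ballot 0 ⋆ ballot 0) j ≡⟨ ballot-convolution 0 0 j ⟩
  ballot 1 j             ∎

mutual
  completions : ℕ → ℕ → ℕ
  completions s       zero    = 1
  completions zero    (suc k) = completions 1 k + skipping k
  completions (suc s) (suc k) = completions s (suc k) + completions (suc (suc s)) k

  skipping : ℕ → ℕ
  skipping zero    = 0
  skipping (suc k) = completions 1 k

module _ {F : ℕ → ℕ} (isFine : IsFineSequence F) where

  Fine-recurrence : ∀ k → F (suc (suc k)) ≡ (catalanSq ⋆ F) k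
  Fine-recurrence k = trans (isFine (suc (suc k))) (sumTo≡∑ (suc (suc k)) (λ i → gCoeff i * F (suc (suc k) ∸ i)))

  mutual
    completions≡ballot⋆Fine : ∀ s k → completions s k ≡ (ballot s ⋆ F) k
    completions≡ballot⋆Fine s zero = sym (trans (+-identityʳ _) (trans (+-identityʳ _) (isFine 0)))
    completions≡ballot⋆Fine zero (suc k) = begin
      completions 1 k + skipping k   ≡⟨ cong₂ _+_ (completions≡ballot⋆Fine 1 k) (skipping≡Fine k) ⟩
      (ballot 1 ⋆ F) k + F (suc k)   ≡⟨ +-comm _ (F (suc k)) ⟩
      F (suc k) + (ballot 1 ⋆ F) k   ≡⟨ ⋆-ballot-0 F k ⟨
      (ballot 0 ⋆ F) (suc k)         ∎
    completions≡ballot⋆Fine (suc s) (suc k) = begin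
      completions s (suc k) + completions (suc (suc s)) k
        ≡⟨ cong₂ _+_ (completions≡ballot⋆Fine s (suc k)) (completions≡ballot⋆Fine (suc (suc s)) k) ⟩
      (ballot s ⋆ F) (suc k) + (ballot (suc (suc s)) ⋆ F) k
        ≡⟨ ⋆-ballot-suc F s k ⟨
      (ballot (suc s) ⋆ F) (suc k)
        ∎

    skipping≡Fine : ∀ k → skipping k ≡ F (suc k)
    skipping≡Fine zero    = sym (isFine 1)
    skipping≡Fine (suc k) = begin
      completions 1 k       ≡⟨ completions≡ballot⋆Fine 1 k ⟩
      (ballot 1 ⋆ F) k      ≡⟨ ∑-cong (suc k) (λ i → cong (_* F (k ∸ i)) (catalanSq≡ballot i)) ⟨
      (catalanSq ⋆ F) k     ≡⟨ Fine-recurrence k ⟨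
      F (suc (suc k))       ∎

  completions-0≡catalan⋆Fine : ∀ n → completions 0 n ≡ sumTo n (λ i → catalan i * F (n ∸ i))
  completions-0≡catalan⋆Fine n = begin
    completions 0 n          ≡⟨ completions≡ballot⋆Fine 0 n ⟩
    (ballot 0 ⋆ F) n         ≡⟨ ∑-cong (suc n) (λ i → cong (_* F (n ∸ i)) (catalan≡ballot i)) ⟨
    (catalan ⋆ F) n          ≡⟨ sumTo≡∑ n _ ⟨
    sumTo n (λ i → catalan i * F (n ∸ i)) ∎

-- Ascending 1-Naples parking functions

length-filterᵇ-++ : ∀ {A : Set} (P : A → Bool) xs ys →
  length (filterᵇ P (xs ++ ys)) ≡ length (filterᵇ P xs) + length (filterᵇ P ys)
length-filterᵇ-++ P xs ys = trans (cong length (filter-++ (T? ∘ P) xs ys)) (length-++ (filterᵇ P xs))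

length-filterᵇ-cong : ∀ {A : Set} {P Q : A → Bool} → (∀ x → P x ≡ Q x) →
  ∀ xs → length (filterᵇ P xs) ≡ length (filterᵇ Q xs)
length-filterᵇ-cong P≗Q xs =
  cong length (filter-≐ (T? ∘ _) (T? ∘ _) ((λ {x} → subst T (P≗Q x)) , (λ {x} → subst T (sym (P≗Q x)))) xs)

length-filterᵇ-false : ∀ {A : Set} (xs : List A) → length (filterᵇ (λ _ → false) xs) ≡ 0
length-filterᵇ-false []       = refl
length-filterᵇ-false (x ∷ xs) = length-filterᵇ-false xs

length-filterᵇ-map : ∀ {A B : Set} (P : B → Bool) (f : A → B) xs → length (filterᵇ P (map f xs)) ≡ length (filterᵇ (P ∘ f) xs)
length-filterᵇ-map P f []       = refl
length-filterᵇ-map P f (x ∷ xs) with P (f x)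
... | true  = cong suc (length-filterᵇ-map P f xs)
... | false = length-filterᵇ-map P f xs

length-filterᵇ-concatMap : ∀ {A B : Set} (P : B → Bool) (g : A → List B) xs →
  length (filterᵇ P (concatMap g xs)) ≡ sum (map (λ x → length (filterᵇ P (g x))) xs)
length-filterᵇ-concatMap P g []       = refl
length-filterᵇ-concatMap P g (x ∷ xs) =
  trans (length-filterᵇ-++ P (g x) (concatMap g xs)) (cong (length (filterᵇ P (g x)) +_) (length-filterᵇ-concatMap P g xs))

<⇒<ᵇ≡true : ∀ {m n} → m < n → (m <ᵇ n) ≡ true
<⇒<ᵇ≡true m<n = Equivalence.to T-≡ (<⇒<ᵇ m<n)

≮⇒<ᵇ≡false : ∀ {m n} → ¬ m < n → (m <ᵇ n) ≡ false
≮⇒<ᵇ≡false {m} {n} m≮n = ¬-not (λ e → m≮n (<ᵇ⇒< m n (Equivalence.from T-≡ e)))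

≡ᵇ-refl : ∀ m → (m ≡ᵇ m) ≡ true
≡ᵇ-refl m = Equivalence.to T-≡ (≡⇒≡ᵇ m m refl)

≢⇒≡ᵇ≡false : ∀ {m n} → m ≢ n → (m ≡ᵇ n) ≡ false
≢⇒≡ᵇ≡false {m} {n} m≢n = ¬-not (λ e → m≢n (≡ᵇ⇒≡ m n (Equivalence.from T-≡ e)))

≤ᵇ≡true⇒≤ : ∀ {m n} → (m ≤ᵇ n) ≡ true → m ≤ n
≤ᵇ≡true⇒≤ {m} {n} e = ≤ᵇ⇒≤ m n (Equivalence.from T-≡ e)

m+1+n≡o⇒m<o : ∀ {m n o} → m + suc n ≡ o → m < o
m+1+n≡o⇒m<o {m} e = subst (m <_) e (m<m+n m z<s)

Occupancy : Set
Occupancy = ℕ → Bool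

-- occupied (s ∷ occ) reduces to occupy s (occupied occ), so Defs' parking runs inside this model.
occupy : ℕ → Occupancy → Occupancy
occupy s O p = (s ≡ᵇ p) ∨ O p

occupy-self : ∀ s O → occupy s O s ≡ true
occupy-self s O = cong (_∨ O s) (≡ᵇ-refl s)

occupy-other : ∀ {s p} O → s ≢ p → occupy s O p ≡ O p
occupy-other {p = p} O s≢p = cong (_∨ O p) (≢⇒≡ᵇ≡false s≢p)

occupy-comm : ∀ a b O p → occupy a (occupy b O) p ≡ occupy b (occupy a O) p
occupy-comm a b O p with a ≡ᵇ p | b ≡ᵇ p
... | true  | true  = refl
... | true  | false = refl
... | false | _     = refl

spotsAfter : ℕ → ℕ → List ℕ
spotsAfter a zero    = []
spotsAfter a (suc c) = suc a ∷ spotsAfter (suc a) c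

applyUpTo-spotsAfter : ∀ a c {f : ℕ → ℕ} → (∀ i → f i ≡ suc (a + i)) → applyUpTo f c ≡ spotsAfter a c
applyUpTo-spotsAfter a zero    f≗ = refl
applyUpTo-spotsAfter a (suc c) f≗ =
  cong₂ _∷_ (trans (f≗ 0) (cong suc (+-identityʳ a))) (applyUpTo-spotsAfter (suc a) c (λ i → trans (f≗ (suc i)) (cong suc (+-suc a i))))

firstFree : Occupancy → List ℕ → Maybe ℕ
firstFree O []       = nothing
firstFree O (b ∷ bs) = if O b then firstFree O bs else just b

firstFree-unique : ∀ {G : List ℕ → Maybe ℕ} O → G [] ≡ nothing →
  (∀ b bs → G (b ∷ bs) ≡ (if O b then G bs else just b)) → ∀ bs → G bs ≡ firstFree O bs
firstFree-unique O G[] G∷ []       = G[]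
firstFree-unique O G[] G∷ (b ∷ bs) = trans (G∷ b bs) (cong (if O b then_else just b) (firstFree-unique O G[] G∷ bs))

firstFree-spotsAfter-sound : ∀ O a c {s} → firstFree O (spotsAfter a c) ≡ just s → O s ≡ false × a < s × s ≤ a + c
firstFree-spotsAfter-sound O a zero    ()
firstFree-spotsAfter-sound O a (suc c) {s} e with O (suc a) in O[1+a]
... | true  with firstFree-spotsAfter-sound O (suc a) c e
...   | Os , 1+a<s , s≤1+a+c = Os , <-trans (n<1+n a) 1+a<s , subst (s ≤_) (sym (+-suc a c)) s≤1+a+c
firstFree-spotsAfter-sound O a (suc c) refl | false =
  O[1+a] , n<1+n a , subst (suc a ≤_) (sym (+-suc a c)) (s≤s (m≤m+n a c))

increasingFrom : ℕ → List ℕ → Bool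
increasingFrom lo []       = true
increasingFrom lo (a ∷ as) = (lo ≤ᵇ a) ∧ increasingFrom a as

weaklyIncreasing≡increasingFrom-0 : ∀ as → weaklyIncreasing as ≡ increasingFrom 0 as
weaklyIncreasing≡increasingFrom-0 []       = refl
weaklyIncreasing≡increasingFrom-0 (a ∷ as) = go a as
  where
  go : ∀ a as → weaklyIncreasing (a ∷ as) ≡ increasingFrom a as
  go a []       = refl
  go a (b ∷ as) = cong ((a ≤ᵇ b) ∧_) (go b as)

record IsPrefix (r : ℕ) (O : Occupancy) : Set where
  field
    occupied-≤ : ∀ {p} → 1 ≤ p → p ≤ r → O p ≡ true
    free-> : ∀ {p} → r < p → O p ≡ false

open IsPrefix

IsPrefix-empty : IsPrefix 0 (λ _ → false)
IsPrefix-empty = record { occupied-≤ = λ { (s≤s _) () } ; free-> = λ _ → refl }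

IsPrefix-occupy : ∀ {r O} → IsPrefix r O → IsPrefix (suc r) (occupy (suc r) O)
IsPrefix-occupy {r} {O} P = record { occupied-≤ = occupied-≤′ ; free-> = free->′ }
  where
  occupied-≤′ : ∀ {p} → 1 ≤ p → p ≤ suc r → occupy (suc r) O p ≡ true
  occupied-≤′ {p} 1≤p p≤1+r with suc r ≟ p
  ... | yes refl = occupy-self (suc r) O
  ... | no 1+r≢p = trans (occupy-other O 1+r≢p) (occupied-≤ P 1≤p (≤-pred (≤∧≢⇒< p≤1+r (1+r≢p ∘ sym))))
  free->′ : ∀ {p} → suc r < p → occupy (suc r) O p ≡ false
  free->′ 1+r<p = trans (occupy-other O (<⇒≢ 1+r<p)) (free-> P (<-trans (n<1+n r) 1+r<p))

IsPrefix-≗ : ∀ {r O O′} → (∀ p → O p ≡ O′ p) → IsPrefix r O → IsPrefix r O′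
IsPrefix-≗ O≗O′ P = record
  { occupied-≤ = λ {p} 1≤p p≤r → trans (sym (O≗O′ p)) (occupied-≤ P 1≤p p≤r)
  ; free->     = λ {p} r<p → trans (sym (O≗O′ p)) (free-> P r<p)
  }

IsPrefix-occupy-below : ∀ {r O} → IsPrefix r O → IsPrefix (suc (suc r)) (occupy (suc r) (occupy (suc (suc r)) O))
IsPrefix-occupy-below {r} {O} P = IsPrefix-≗ (occupy-comm (suc (suc r)) (suc r) O) (IsPrefix-occupy (IsPrefix-occupy P))

firstFree-prefix : ∀ {r O} → IsPrefix r O → ∀ a c → a ≤ r → r < a + c → firstFree O (spotsAfter a c) ≡ just (suc r)
firstFree-prefix P a zero    a≤r r<a+0 = ⊥-elim (<-irrefl refl (<-≤-trans r<a+0 (subst (_≤ _) (sym (+-identityʳ a)) a≤r)))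
firstFree-prefix {r} P a (suc c) a≤r r<a+1+c with a <? r
... | yes a<r rewrite occupied-≤ P (s≤s z≤n) a<r = firstFree-prefix P (suc a) c a<r (subst (r <_) (+-suc a c) r<a+1+c)
... | no a≮r with ≤-antisym a≤r (≮⇒≥ a≮r)
...   | refl rewrite free-> P (n<1+n a) = refl

module Parking (n : ℕ) where

  park : Occupancy → ℕ → Maybe ℕ
  park O a =
    if not (O a) then just a
    else (if (1 <ᵇ a) ∧ not (O (a ∸ 1)) then just (a ∸ 1)
          else firstFree O (spotsAfter a (n ∸ a)))

  firstEmptyAfter≡firstFree : ∀ occ a → firstEmptyAfter n occ a ≡ firstFree (occupied occ) (spotsAfter a (n ∸ a))
  firstEmptyAfter≡firstFree occ a =
    trans go≡firstFree (cong (firstFree (occupied occ)) (trans (map-applyUpTo id _ (n ∸ a)) (applyUpTo-spotsAfter a (n ∸ a) (λ _ → refl))))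
    where
    -- The local go of firstEmptyAfter cannot be named; abstracting its argument lets
    -- firstFree-unique pin it down by its defining equations.
    go≡firstFree : firstEmptyAfter n occ a ≡ firstFree (occupied occ) (map (λ i → suc (a + i)) (upTo (n ∸ a)))
    go≡firstFree with firstFree-unique (occupied occ) refl (λ _ _ → refl) | map (λ i → suc (a + i)) (upTo (n ∸ a))
    ... | unique | bs = unique bs

  parkCar≡park : ∀ occ a → parkCar n occ a ≡ park (occupied occ) a
  parkCar≡park occ a rewrite firstEmptyAfter≡firstFree occ a = refl

  parksAll : Occupancy → List ℕ → Bool
  parksAll O []       = true
  parksAll O (a ∷ as) = maybe′ (λ s → parksAll (occupy s O) as) false (park O a)

  is-just-parkAll≡parksAll : ∀ occ as → is-just (parkAll n occ as) ≡ parksAll (occupied occ) as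
  is-just-parkAll≡parksAll occ []       = refl
  is-just-parkAll≡parksAll occ (a ∷ as) with parkCar n occ a | parkCar≡park occ a
  ... | nothing | e rewrite sym e = refl
  ... | just s  | e rewrite sym e = is-just-parkAll≡parksAll (s ∷ occ) as

  mutual
    parkingCount : ℕ → ℕ → Occupancy → ℕ
    parkingCount zero    lo O = 1
    parkingCount (suc k) lo O = ∑ n (λ i → if lo ≤ᵇ suc i then parkingCountFrom k O (suc i) else 0)

    parkingCountFrom : ℕ → Occupancy → ℕ → ℕ
    parkingCountFrom k O v = maybe′ (λ s → parkingCount k v (occupy s O)) 0 (park O v)

  admissible : ℕ → Occupancy → List ℕ → Bool
  admissible lo O as = increasingFrom lo as ∧ parksAll O as

  mutual
    length-filter-admissible : ∀ k lo O → length (filterᵇ (admissible lo O) (allSeqs k n)) ≡ parkingCount k lo O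
    length-filter-admissible zero    lo O = refl
    length-filter-admissible (suc k) lo O = begin
      length (filterᵇ (admissible lo O) (concatMap (λ v → map (v ∷_) (allSeqs k n)) (map suc (upTo n))))
        ≡⟨ length-filterᵇ-concatMap (admissible lo O) (λ v → map (v ∷_) (allSeqs k n)) (map suc (upTo n)) ⟩
      sum (map count-∷ (map suc (upTo n)))
        ≡⟨ trans (cong (sum ∘ map count-∷) (map-applyUpTo id suc n)) (sum-map-applyUpTo n count-∷ suc) ⟩
      ∑ n (λ i → count-∷ (suc i))
        ≡⟨ ∑-cong n (λ i → trans (length-filterᵇ-map (admissible lo O) (suc i ∷_) (allSeqs k n))
                                 (length-filter-admissible-∷ k lo O (suc i))) ⟩
      ∑ n (λ i → if lo ≤ᵇ suc i then parkingCountFrom k O (suc i) else 0) ∎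
      where
      count-∷ : ℕ → ℕ
      count-∷ v = length (filterᵇ (admissible lo O) (map (v ∷_) (allSeqs k n)))

    length-filter-admissible-∷ : ∀ k lo O v →
      length (filterᵇ (admissible lo O ∘ (v ∷_)) (allSeqs k n)) ≡ (if lo ≤ᵇ v then parkingCountFrom k O v else 0)
    length-filter-admissible-∷ k lo O v with lo ≤ᵇ v
    ... | false = length-filterᵇ-false (allSeqs k n)
    ... | true with park O v
    ...   | nothing = trans (length-filterᵇ-cong (λ as → ∧-zeroʳ (increasingFrom v as)) (allSeqs k n)) (length-filterᵇ-false (allSeqs k n))
    ...   | just s  = length-filter-admissible k v (occupy s O)

  I₁≡parkingCount : I₁ n ≡ parkingCount n 1 (λ _ → false)
  I₁≡parkingCount = trans (length-filterᵇ-cong admissible≗ (allSeqs n n)) (trans (length-filter-admissible n 0 _) (lower-bound-0 n))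
    where
    admissible≗ : ∀ as → (weaklyIncreasing as ∧ isNaplesPF n as) ≡ admissible 0 (λ _ → false) as
    admissible≗ as = cong₂ _∧_ (weaklyIncreasing≡increasingFrom-0 as) (is-just-parkAll≡parksAll [] as)
    lower-bound-0 : ∀ k → parkingCount k 0 (λ _ → false) ≡ parkingCount k 1 (λ _ → false)
    lower-bound-0 zero    = refl
    lower-bound-0 (suc k) = refl

  park-free : ∀ O {v} → O v ≡ false → park O v ≡ just v
  park-free O Ov rewrite Ov = refl

  park-back : ∀ O {v} → O (suc (suc v)) ≡ true → O (suc v) ≡ false → park O (suc (suc v)) ≡ just (suc v)
  park-back O O[2+v] O[1+v] rewrite O[2+v] | O[1+v] = refl

  park-prefix : ∀ {r O} → IsPrefix r O → ∀ {v} → 1 ≤ v → v ≤ r → r < n → park O v ≡ just (suc r)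
  park-prefix P {suc zero} 1≤v v≤r r<n rewrite occupied-≤ P 1≤v v≤r =
    firstFree-prefix P 1 (n ∸ 1) v≤r (subst (_ <_) (sym (m+[n∸m]≡n (≤-trans v≤r (<⇒≤ r<n)))) r<n)
  park-prefix P {suc (suc v)} 1≤v v≤r r<n rewrite occupied-≤ P 1≤v v≤r | occupied-≤ P (s≤s z≤n) (≤-trans (n≤1+n _) v≤r) =
    firstFree-prefix P (suc (suc v)) (n ∸ suc (suc v)) v≤r (subst (_ <_) (sym (m+[n∸m]≡n (≤-trans v≤r (<⇒≤ r<n)))) r<n)

  drives-forward : ∀ O {v s} → 1 ≤ v → v ≤ n → firstFree O (spotsAfter v (n ∸ v)) ≡ just s →
    O s ≡ false × v ∸ 1 ≤ s × 1 ≤ s × s ≤ n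
  drives-forward O {v} {s} 1≤v v≤n e =
    let (Os , v<s , s≤v+[n∸v]) = firstFree-spotsAfter-sound O v (n ∸ v) e
    in Os , ≤-trans (m∸n≤m v 1) (<⇒≤ v<s) , ≤-trans 1≤v (<⇒≤ v<s) , subst (s ≤_) (m+[n∸m]≡n v≤n) s≤v+[n∸v]

  park-sound : ∀ O {v s} → 1 ≤ v → v ≤ n → park O v ≡ just s → O s ≡ false × v ∸ 1 ≤ s × 1 ≤ s × s ≤ n
  park-sound O {v} 1≤v v≤n e with O v in Ov
  park-sound O 1≤v v≤n refl | false = Ov , m∸n≤m _ 1 , 1≤v , v≤n
  park-sound O {v} 1≤v v≤n e | true with 1 <ᵇ v in 1<v | O (v ∸ 1) in Ov∸1
  park-sound O {suc (suc v)} 1≤v v≤n refl | true | true  | false = Ov∸1 , ≤-refl , s≤s z≤n , ≤-trans (n≤1+n _) v≤n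
  park-sound O {v} 1≤v v≤n e | true | true  | true  = drives-forward O 1≤v v≤n e
  park-sound O {v} 1≤v v≤n e | true | false | _     = drives-forward O 1≤v v≤n e

  freeSpots : Occupancy → ℕ
  freeSpots O = ∑ n (λ i → if O (suc i) then 0 else 1)

  freeSpots-occupy : ∀ O {s} → 1 ≤ s → s ≤ n → O s ≡ false → freeSpots O ≡ suc (freeSpots (occupy s O))
  freeSpots-occupy O {suc s} _ 1+s≤n Os = begin
    freeSpots O
      ≡⟨ ∑-cong n split ⟩
    ∑ n (λ i → (if i ≡ᵇ s then 1 else 0) + (if occupy (suc s) O (suc i) then 0 else 1))
      ≡⟨ ∑-distrib-+ n (λ i → if i ≡ᵇ s then 1 else 0) _ ⟩
    ∑ n (λ i → if i ≡ᵇ s then 1 else 0) + freeSpots (occupy (suc s) O)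
      ≡⟨ cong (_+ freeSpots (occupy (suc s) O))
              (trans (∑-indicator n s (λ _ → 1)) (cong (λ b → if b then 1 else 0) (<⇒<ᵇ≡true 1+s≤n))) ⟩
    suc (freeSpots (occupy (suc s) O)) ∎
    where
    split : ∀ i → (if O (suc i) then 0 else 1) ≡ (if i ≡ᵇ s then 1 else 0) + (if occupy (suc s) O (suc i) then 0 else 1)
    split i with i ≟ s
    ... | yes refl rewrite ≡ᵇ-refl i | Os = refl
    ... | no i≢s rewrite ≢⇒≡ᵇ≡false i≢s | ≢⇒≡ᵇ≡false (i≢s ∘ sym) = refl

  freeSpots-prefix : ∀ {r k O} → IsPrefix r O → r + k ≡ n → freeSpots O ≡ k
  freeSpots-prefix {r} {k} {O} P r+k≡n = begin
    ∑ n isFree                               ≡⟨ cong (λ m → ∑ m isFree) (sym r+k≡n) ⟩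
    ∑ (r + k) isFree                         ≡⟨ ∑-split r k isFree ⟩
    ∑ r isFree + ∑ k (λ i → isFree (r + i))  ≡⟨ cong₂ _+_ (∑-≡0 r occupied-part) (∑-cong k free-part) ⟩
    ∑ k (λ _ → 1)                            ≡⟨ ∑-const k 1 ⟩
    k * 1                                    ≡⟨ *-identityʳ k ⟩
    k                                        ∎
    where
    isFree : ℕ → ℕ
    isFree i = if O (suc i) then 0 else 1
    occupied-part : ∀ i → i < r → isFree i ≡ 0
    occupied-part i i<r = cong (λ b → if b then 0 else 1) (occupied-≤ P (s≤s z≤n) i<r)
    free-part : ∀ i → isFree (r + i) ≡ 1
    free-part i = cong (λ b → if b then 0 else 1) (free-> P (s≤s (m≤m+n r i)))

  -- A car never parks below its preference minus one, so spot x stays empty while the k cars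
  -- would have to fill all k free spots.
  parkingCount-stranded : ∀ k {lo O x} → 1 ≤ x → x ≤ n → O x ≡ false → suc (suc x) ≤ lo → freeSpots O ≡ k →
    parkingCount k lo O ≡ 0
  parkingCount-stranded zero    {O = O} 1≤x x≤n Ox _ free≡0 = ⊥-elim (0≢1+n (trans (sym free≡0) (freeSpots-occupy O 1≤x x≤n Ox)))
  parkingCount-stranded (suc k) {lo} {O} {x} 1≤x x≤n Ox 2+x≤lo free≡1+k = ∑-≡0 n (λ i i<n → no-first-car (suc i) (s≤s z≤n) i<n)
    where
    no-first-car : ∀ v → 1 ≤ v → v ≤ n → (if lo ≤ᵇ v then parkingCountFrom k O v else 0) ≡ 0
    no-first-car v 1≤v v≤n with lo ≤ᵇ v in lo≤v
    ... | false = refl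
    ... | true with park O v in parked
    ...   | nothing = refl
    ...   | just s with park-sound O 1≤v v≤n parked
    ...     | Os , v∸1≤s , 1≤s , s≤n =
      parkingCount-stranded k 1≤x x≤n (trans (occupy-other O (<⇒≢ x<s ∘ sym)) Ox) 2+x≤v
        (suc-injective (trans (sym (freeSpots-occupy O 1≤s s≤n Os)) free≡1+k))
      where
      2+x≤v : suc (suc x) ≤ v
      2+x≤v = ≤-trans 2+x≤lo (≤ᵇ≡true⇒≤ lo≤v)
      x<s : x < s
      x<s = ≤-trans (∸-monoˡ-≤ 1 2+x≤v) v∸1≤s

  parkingCount-peel : ∀ k lo O → lo < n →
    parkingCount (suc k) (suc lo) O ≡ parkingCountFrom k O (suc lo) + parkingCount (suc k) (suc (suc lo)) O
  parkingCount-peel k lo O lo<n = begin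
    ∑ n (λ i → if lo <ᵇ suc i then g i else 0)
      ≡⟨ ∑-cong n split ⟩
    ∑ n (λ i → (if i ≡ᵇ lo then g i else 0) + (if lo <ᵇ i then g i else 0))
      ≡⟨ ∑-distrib-+ n (λ i → if i ≡ᵇ lo then g i else 0) _ ⟩
    ∑ n (λ i → if i ≡ᵇ lo then g i else 0) + parkingCount (suc k) (suc (suc lo)) O
      ≡⟨ cong (_+ parkingCount (suc k) (suc (suc lo)) O)
              (trans (∑-indicator n lo g) (cong (λ b → if b then g lo else 0) (<⇒<ᵇ≡true lo<n))) ⟩
    g lo + parkingCount (suc k) (suc (suc lo)) O
      ∎
    where
    g : ℕ → ℕ
    g i = parkingCountFrom k O (suc i)
    split : ∀ i → (if lo <ᵇ suc i then g i else 0) ≡ (if i ≡ᵇ lo then g i else 0) + (if lo <ᵇ i then g i else 0)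
    split i with <-cmp i lo
    ... | tri< i<lo _ _
      rewrite ≮⇒<ᵇ≡false {lo} {suc i} (<⇒≱ i<lo ∘ ≤-pred) | ≢⇒≡ᵇ≡false (<⇒≢ i<lo) | ≮⇒<ᵇ≡false (<-asym i<lo) = refl
    ... | tri≈ _ refl _ rewrite <⇒<ᵇ≡true (n<1+n i) | ≡ᵇ-refl i | ≮⇒<ᵇ≡false {i} {i} (<-irrefl refl) = sym (+-identityʳ (g i))
    ... | tri> _ _ lo<i rewrite <⇒<ᵇ≡true (<-trans lo<i (n<1+n i)) | ≢⇒≡ᵇ≡false (<⇒≢ lo<i ∘ sym) | <⇒<ᵇ≡true lo<i = refl

  parkingCount-first : ∀ k {lo O s} → lo < n → park O (suc lo) ≡ just s →
    parkingCount (suc k) (suc lo) O ≡ parkingCount k (suc lo) (occupy s O) + parkingCount (suc k) (suc (suc lo)) O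
  parkingCount-first k {lo} {O} lo<n parked =
    trans (parkingCount-peel k lo O lo<n) (cong (λ c → maybe′ (λ s → parkingCount k (suc lo) (occupy s O)) 0 c + rest) parked)
    where
    rest : ℕ
    rest = parkingCount (suc k) (suc (suc lo)) O

  parkingCount-beyond : ∀ k lo O → n < lo → parkingCount (suc k) lo O ≡ 0
  parkingCount-beyond k lo O n<lo = ∑-≡0 n (λ i i<n → cong (λ b → if b then parkingCountFrom k O (suc i) else 0) (lo≰ i i<n))
    where
    lo≰ : ∀ i → i < n → (lo ≤ᵇ suc i) ≡ false
    lo≰ i i<n = ¬-not (λ e → <⇒≱ n<lo (≤-trans (≤ᵇ≡true⇒≤ e) i<n))

  mutual
    parkingCount-prefix : ∀ k s m r {O} → IsPrefix r O → r + k ≡ n → m + s ≡ r → parkingCount k (suc m) O ≡ completions s k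
    parkingCount-prefix zero    s       m r P r+k≡n m+s≡r = refl
    parkingCount-prefix (suc k) zero    m r {O} P r+1+k≡n m+0≡r with trans (sym (+-identityʳ m)) m+0≡r
    ... | refl = begin
      parkingCount (suc k) (suc m) O
        ≡⟨ parkingCount-first k (m+1+n≡o⇒m<o r+1+k≡n) (park-free O (free-> P (n<1+n m))) ⟩
      parkingCount k (suc m) (occupy (suc m) O) + parkingCount (suc k) (suc (suc m)) O
        ≡⟨ cong₂ _+_ (parkingCount-prefix k 1 m (suc m) (IsPrefix-occupy P) (trans (sym (+-suc m k)) r+1+k≡n) (+-comm m 1))
                     (parkingCount-after-prefix k m P r+1+k≡n) ⟩
      completions 1 k + skipping k
        ∎
    parkingCount-prefix (suc k) (suc s) m r {O} P r+1+k≡n m+1+s≡r = begin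
      parkingCount (suc k) (suc m) O
        ≡⟨ parkingCount-first k (<-≤-trans m<r (<⇒≤ r<n)) (park-prefix P (s≤s z≤n) m<r r<n) ⟩
      parkingCount k (suc m) (occupy (suc r) O) + parkingCount (suc k) (suc (suc m)) O
        ≡⟨ cong₂ _+_ (parkingCount-prefix k (suc (suc s)) m (suc r) (IsPrefix-occupy P) (trans (sym (+-suc r k)) r+1+k≡n)
                                          (trans (+-suc m (suc s)) (cong suc m+1+s≡r)))
                     (parkingCount-prefix (suc k) s (suc m) r P r+1+k≡n (trans (sym (+-suc m s)) m+1+s≡r)) ⟩
      completions (suc (suc s)) k + completions s (suc k)
        ≡⟨ +-comm (completions (suc (suc s)) k) _ ⟩
      completions (suc s) (suc k)
        ∎
      where
      m<r : m < r
      m<r = m+1+n≡o⇒m<o m+1+s≡r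
      r<n : r < n
      r<n = m+1+n≡o⇒m<o r+1+k≡n

    parkingCount-after-prefix : ∀ k r {O} → IsPrefix r O → r + suc k ≡ n → parkingCount (suc k) (suc (suc r)) O ≡ skipping k
    parkingCount-after-prefix zero    r {O} P r+1≡n =
      parkingCount-beyond 0 (suc (suc r)) O (subst (_< suc (suc r)) (trans (+-comm 1 r) r+1≡n) ≤-refl)
    parkingCount-after-prefix (suc k) r {O} P r+2+k≡n = begin
      parkingCount (suc (suc k)) (suc (suc r)) O
        ≡⟨ parkingCount-first (suc k) 1+r<n (park-free O (free-> P (m<n⇒m<1+n (n<1+n r)))) ⟩
      parkingCount (suc k) (suc (suc r)) (occupy (suc (suc r)) O) + parkingCount (suc (suc k)) (suc (suc (suc r))) O
        ≡⟨ cong₂ _+_ (parkingCount-skip k r P r+2+k≡n)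
                     (parkingCount-stranded (suc (suc k)) {O = O} (s≤s z≤n) (<⇒≤ 1+r<n) (free-> P (n<1+n r)) ≤-refl
                                            (freeSpots-prefix P r+2+k≡n)) ⟩
      completions 1 k + 0
        ≡⟨ +-identityʳ _ ⟩
      completions 1 k
        ∎
      where
      1+r<n : suc r < n
      1+r<n = m+1+n≡o⇒m<o (trans (sym (+-suc r (suc k))) r+2+k≡n)

    parkingCount-skip : ∀ k r {O} → IsPrefix r O → r + suc (suc k) ≡ n →
      parkingCount (suc k) (suc (suc r)) (occupy (suc (suc r)) O) ≡ completions 1 k
    parkingCount-skip k r {O} P r+2+k≡n = begin
      parkingCount (suc k) (suc (suc r)) O′
        ≡⟨ parkingCount-first k 1+r<n (park-back O′ (occupy-self (suc (suc r)) O) O′[1+r]) ⟩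
      parkingCount k (suc (suc r)) (occupy (suc r) O′) + parkingCount (suc k) (suc (suc (suc r))) O′
        ≡⟨ cong₂ _+_ (parkingCount-prefix k 1 (suc r) (suc (suc r)) (IsPrefix-occupy-below P) 2+r+k≡n (+-comm (suc r) 1))
                     (parkingCount-stranded (suc k) {O = O′} (s≤s z≤n) (<⇒≤ 1+r<n) O′[1+r] ≤-refl free≡1+k) ⟩
      completions 1 k + 0
        ≡⟨ +-identityʳ _ ⟩
      completions 1 k
        ∎
      where
      O′ : Occupancy
      O′ = occupy (suc (suc r)) O
      2+r+k≡n : suc (suc r) + k ≡ n
      2+r+k≡n = trans (cong suc (sym (+-suc r k))) (trans (sym (+-suc r (suc k))) r+2+k≡n)
      1+r<n : suc r < n
      1+r<n = m+1+n≡o⇒m<o (trans (sym (+-suc r (suc k))) r+2+k≡n)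
      O′[1+r] : O′ (suc r) ≡ false
      O′[1+r] = trans (occupy-other O (<⇒≢ (n<1+n (suc r)) ∘ sym)) (free-> P (n<1+n r))
      free≡1+k : freeSpots O′ ≡ suc k
      free≡1+k = suc-injective (trans (sym (freeSpots-occupy O (s≤s z≤n) 1+r<n (free-> P (m<n⇒m<1+n (n<1+n r)))))
                                      (freeSpots-prefix P r+2+k≡n))

theorem5p5 : (F : ℕ → ℕ) → IsFineSequence F →
    ∀ n → I₁ n ≡ sumTo n (λ i → catalan i * F (n ∸ i))
theorem5p5 F isFine n = begin
  I₁ n                                   ≡⟨ I₁≡parkingCount ⟩
  parkingCount n 1 (λ _ → false)         ≡⟨ parkingCount-prefix n 0 0 0 IsPrefix-empty refl refl ⟩
  completions 0 n                        ≡⟨ completions-0≡catalan⋆Fine isFine n ⟩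
  sumTo n (λ i → catalan i * F (n ∸ i))  ∎
  where open Parking n
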